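{- Let $n>1$ be an odd integer and let $\pi=[a_1\,a_2\,\cdots\,a_n]\in\mathsf{S}_n$. If the strategic pile $\mathsf{SP}(\pi)$ has $n-2$ elements, then $\pi$ has a single adjacency, i.e. there is exactly one index $i<n$ with $a_{i+1}=a_i+1$.
   Context: $\mathsf{S}_n$ is the set of permutations of $\{1,\dots,n\}$; $[a_1\cdots a_n]$ is one-line notation ($\pi(i)=a_i$); cycles $(c_1\cdots c_k)$ send $c_1\mapsto\cdots\mapsto c_k\mapsto c_1$; composition is right-to-left. Let $X_n=(0\;1\;\cdots\;n)$, $Y_\pi=(0\;a_n\;\cdots\;a_1)$, $C_\pi=Y_\pi\circ X_n$ (permutations of $\{0,\dots,n\}$). If $0$ and $n$ are in the same cycle of $C_\pi$, written $(0\;u_1\cdots u_j\;n\;b_1\cdots b_k)$, then $\mathsf{SP}(\pi)=\{b_1,\dots,b_k\}$; otherwise $\mathsf{SP}(\pi)=\emptyset$. -}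

module Defs where

open import Data.Nat using (ℕ; zero; suc; _<?_)
open import Data.Fin using (Fin; zero; suc; toℕ; fromℕ; fromℕ<; inject₁; _≟_)
open import Data.Fin.Permutation using (Permutation′; _⟨$⟩ʳ_; _⟨$⟩ˡ_)
open import Data.List using (List; []; _∷_)
open import Data.Product using (∃)
open import Relation.Binary.PropositionalEquality using (_≡_)
open import Relation.Nullary using (yes; no)

-- Convention: position i ∈ {1..n} is the Fin n element with toℕ = i-1, and the
-- value a_i = π(i) ∈ {1..n} is represented by the Fin n element π ⟨$⟩ʳ (i-1),
-- i.e. a_i = suc (toℕ (π ⟨$⟩ʳ (i-1))).
-- The points {0,…,n} are Fin (suc n); the value v ∈ {1..n} (as w : Fin n) is suc w.

Xcyc : (n : ℕ) → Fin (suc n) → Fin (suc n)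
Xcyc n x with toℕ x <? n
... | yes p = suc (fromℕ< p)
... | no _  = zero

-- Y_π = (0 a_m+1 ⋯ a_1) for π ∈ S_(suc m):
--   0 ↦ a_n,  a_1 ↦ 0,  a_i ↦ a_(i-1) for i ≥ 2.
Ycyc : (m : ℕ) → Permutation′ (suc m) → Fin (suc (suc m)) → Fin (suc (suc m))
Ycyc m π zero = suc (π ⟨$⟩ʳ fromℕ m)
Ycyc m π (suc v) with π ⟨$⟩ˡ v
... | zero   = zero
... | suc i' = suc (π ⟨$⟩ʳ inject₁ i')

Ccyc : (m : ℕ) → Permutation′ (suc m) → Fin (suc (suc m)) → Fin (suc (suc m))
Ccyc m π x = Ycyc m π (Xcyc (suc m) x)

-- The elements of the cycle of C containing 0, listed in order after 0:
-- C(0), C²(0), …, until 0 is reached again (fuel suffices: cycle length ≤ n+1).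
cycleFrom : {k : ℕ} → (Fin (suc k) → Fin (suc k)) → ℕ → Fin (suc k) → List (Fin (suc k))
cycleFrom f zero    _       = []
cycleFrom f (suc g) zero    = []
cycleFrom f (suc g) (suc x) = suc x ∷ cycleFrom f g (f (suc x))

after : {k : ℕ} → Fin k → List (Fin k) → List (Fin k)
after t []       = []
after t (x ∷ xs) with x ≟ t
... | yes _ = xs
... | no  _ = after t xs

-- Strategic pile: if the cycle of C_π through 0 is (0 u_1 ⋯ u_j n b_1 ⋯ b_k),
-- SP(π) = {b_1,…,b_k} (listed as [b_1,…,b_k]); otherwise empty.
SP : (n : ℕ) → Permutation′ n → List (Fin (suc n))
SP zero    π = []
SP (suc m) π = after (fromℕ (suc m)) (cycleFrom (Ccyc m π) (suc (suc m)) (Ccyc m π zero))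

val : {n : ℕ} → Permutation′ n → Fin n → ℕ
val π i = suc (toℕ (π ⟨$⟩ʳ i))

-- i (0-based position, i.e. paper index i+1 < n) is an adjacency:
-- the next position j (toℕ j = toℕ i + 1) has a_(next) = a_i + 1.
IsAdjacency : {n : ℕ} → Permutation′ n → Fin n → Set
IsAdjacency {n} π i = ∃ λ (j : Fin n) → (toℕ j ≡ suc (toℕ i)) Data.Product.× (val π j ≡ suc (val π i))

-- C_π = Y_π ∘ X_n is a product of two (n+1)-cycles, hence even, while for odd n an
-- (n+1)-cycle is odd; so the cycle of C_π through 0 is not all of {0,…,n}. If
-- |SP(π)| = n − 2, this cycle contains 0, n and the n − 2 points following n, so it misses
-- exactly one point z. As C_π is injective and maps the cycle onto itself, C_π z = z, and z
-- is the only fixed point, since a cycle with more than one point has none. The fixed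
-- points of C_π other than 0 and n are exactly the values a_i with a_(i+1) = a_i + 1, one
-- for each adjacency of π. Signs are computed as parities of inversion counts of lists.

module Submission where

open import Defs
open import Data.Nat using (ℕ; _<_; _∸_; _%_)
open import Data.Fin using (Fin)
open import Data.Fin.Permutation using (Permutation′)
open import Data.List using (length)
open import Data.Product using (∃!)
open import Relation.Binary.PropositionalEquality using (_≡_)

open import Algebra.Bundles using (CommutativeMonoid)
open import Data.Fin as Fin using (zero; suc; toℕ; fromℕ; inject₁)
import Data.Fin.Properties as Fin
open import Data.Fin.Permutation using (_⟨$⟩ʳ_; _⟨$⟩ˡ_; inverseˡ; inverseʳ)
open import Data.List using (List; []; _∷_; _++_; _∷ʳ_; map; foldr; lookup; tabulate; allFin)
import Data.List.Properties as List
open import Data.List.Membership.Propositional using (_∈_; _∉_)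
open import Data.List.Membership.Propositional.Properties
  using (∈-lookup; ∈-allFin; ∈-map⁺; ∈-map⁻; ∈-++⁺ˡ; ∈-tabulate⁺)
open import Data.List.Membership.Propositional.Properties.WithK using (unique∧set⇒bag)
import Data.List.Membership.DecPropositional as DecMembership
open import Data.List.Relation.Binary.BagAndSetEquality using (∼bag⇒↭)
open import Data.List.Relation.Binary.Permutation.Propositional
  using (_↭_; refl; prep; swap; trans; ↭-sym; ↭-trans; ↭⇒↭ₛ)
import Data.List.Relation.Binary.Permutation.Propositional.Properties as ↭
import Data.List.Relation.Binary.Permutation.Setoid.Properties as ↭ₛ
open import Data.List.Relation.Unary.All as All using (All; []; _∷_)
open import Data.List.Relation.Unary.All.Properties as Allₚ using (¬Any⇒All¬; All¬⇒¬Any)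
open import Data.List.Relation.Unary.Any using (here; there)
open import Data.List.Relation.Unary.Any.Properties using (¬Any[])
open import Data.List.Relation.Unary.Unique.Propositional using (Unique; []; _∷_)
import Data.List.Relation.Unary.Unique.Propositional.Properties as Unique
open import Data.Nat as ℕ using (zero; suc; _≤_; z≤n; s≤s; parity)
import Data.Nat.Properties as ℕ
open import Data.Parity.Base using (Parity; 0ℙ; 1ℙ; _+_; _⁻¹)
open import Data.Parity.Properties
  using ( +-assoc; +-comm; +-identityʳ; p+p≡0ℙ; p+p⁻¹≡1ℙ; ⁻¹-involutive; suc-homo-⁻¹
        ; +-0-commutativeMonoid)
open import Algebra.Properties.CommutativeSemigroup
  (CommutativeMonoid.commutativeSemigroup +-0-commutativeMonoid) using (interchange)
open import Data.Product using (∃; _×_; _,_; proj₁; proj₂)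
open import Data.Sum as Sum using (_⊎_; inj₁; inj₂)
open import Function using (_∘_; Injective)
open import Function.Bundles using (mk⇔)
open import Relation.Binary using (Rel; IsStrictTotalOrder; tri<; tri≈; tri>)
open import Relation.Binary.PropositionalEquality as ≡
  using (_≢_; refl; sym; cong; cong₂; subst; module ≡-Reasoning)
open import Relation.Nullary using (Dec; yes; no; contradiction)

∑ : List Parity → Parity
∑ = foldr _+_ 0ℙ

∑-++ : ∀ ps qs → ∑ (ps ++ qs) ≡ ∑ ps + ∑ qs
∑-++ []       qs = refl
∑-++ (p ∷ ps) qs = ≡.trans (cong (p +_) (∑-++ ps qs)) (sym (+-assoc p (∑ ps) (∑ qs)))

∑-∷ʳ : ∀ ps p → ∑ (ps ∷ʳ p) ≡ ∑ ps + p
∑-∷ʳ ps p = ≡.trans (∑-++ ps (p ∷ [])) (cong (∑ ps +_) (+-identityʳ p))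

∑-↭ : ∀ {ps qs} → ps ↭ qs → ∑ ps ≡ ∑ qs
∑-↭ p = ↭ₛ.foldr-commMonoid CM.setoid CM.isCommutativeMonoid (↭⇒↭ₛ p)
  where module CM = CommutativeMonoid +-0-commutativeMonoid

∑-map-+ : ∀ {a} {A : Set a} (f g : A → Parity) xs →
          ∑ (map (λ x → f x + g x) xs) ≡ ∑ (map f xs) + ∑ (map g xs)
∑-map-+ f g []       = refl
∑-map-+ f g (x ∷ xs) = ≡.trans (cong (f x + g x +_) (∑-map-+ f g xs))
                               (interchange (f x) (g x) (∑ (map f xs)) (∑ (map g xs)))

parity-suc : ∀ n → parity (suc n) ≡ parity n ⁻¹
parity-suc n = ≡.trans (sym (⁻¹-involutive (parity (suc n)))) (cong _⁻¹ (suc-homo-⁻¹ n))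

∑-map-1ℙ : ∀ {a} {A : Set a} {f : A → Parity} {xs} → All (λ x → f x ≡ 1ℙ) xs →
           ∑ (map f xs) ≡ parity (length xs)
∑-map-1ℙ []                      = refl
∑-map-1ℙ {f = f} {xs = x ∷ xs} (fx≡1 ∷ rest) = begin
  f x + ∑ (map f xs)  ≡⟨ cong₂ _+_ fx≡1 (∑-map-1ℙ rest) ⟩
  parity (length xs) ⁻¹ ≡⟨ sym (parity-suc (length xs)) ⟩
  parity (suc (length xs)) ∎
  where open ≡-Reasoning

[p+q]+[q+r]≡p+r : ∀ p q r → (p + q) + (q + r) ≡ p + r
[p+q]+[q+r]≡p+r p q r = begin
  (p + q) + (q + r) ≡⟨ +-assoc p q (q + r) ⟩
  p + (q + (q + r)) ≡⟨ cong (p +_) (sym (+-assoc q q r)) ⟩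
  p + ((q + q) + r) ≡⟨ cong (λ s → p + (s + r)) (p+p≡0ℙ q) ⟩
  p + r             ∎
  where open ≡-Reasoning

p⁻¹+q⁻¹≡p+q : ∀ p q → p ⁻¹ + q ⁻¹ ≡ p + q
p⁻¹+q⁻¹≡p+q 0ℙ 0ℙ = refl
p⁻¹+q⁻¹≡p+q 0ℙ 1ℙ = refl
p⁻¹+q⁻¹≡p+q 1ℙ 0ℙ = refl
p⁻¹+q⁻¹≡p+q 1ℙ 1ℙ = refl

module InversionParity {a ℓ} {A : Set a} {_<_ : Rel A ℓ} (<-sto : IsStrictTotalOrder _≡_ _<_) where
  open IsStrictTotalOrder <-sto using (compare; _≟_)

  ascends : A → A → Parity
  ascends x y with compare x y
  ... | tri< _ _ _ = 1ℙ
  ... | tri≈ _ _ _ = 0ℙ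
  ... | tri> _ _ _ = 0ℙ

  ascends-flip : ∀ {x y} → x ≢ y → ascends y x ≡ ascends x y ⁻¹
  ascends-flip {x} {y} x≢y with compare x y | compare y x
  ... | tri< _ _ y≮x | tri< y<x _ _  = contradiction y<x y≮x
  ... | tri< _ _ _   | tri≈ _ y≡x _  = contradiction (sym y≡x) x≢y
  ... | tri< _ _ _   | tri> _ _ _    = refl
  ... | tri≈ _ x≡y _ | _             = contradiction x≡y x≢y
  ... | tri> _ _ _   | tri< _ _ _    = refl
  ... | tri> _ _ _   | tri≈ _ y≡x _  = contradiction (sym y≡x) x≢y
  ... | tri> x≮y _ _ | tri> _ _ x<y  = contradiction x<y x≮y

  ascentParity : List A → Parity
  ascentParity []       = 0ℙ
  ascentParity (x ∷ xs) = ∑ (map (ascends x) xs) + ascentParity xs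

  ascentParity-∷ʳ : ∀ xs x →
    ascentParity (xs ∷ʳ x) ≡ ascentParity xs + ∑ (map (λ y → ascends y x) xs)
  ascentParity-∷ʳ []       x = refl
  ascentParity-∷ʳ (y ∷ ys) x = begin
    ∑ (map (ascends y) (ys ∷ʳ x)) + ascentParity (ys ∷ʳ x)
      ≡⟨ cong₂ _+_ (≡.trans (cong ∑ (List.map-++ (ascends y) ys (x ∷ [])))
                            (∑-∷ʳ (map (ascends y) ys) (ascends y x)))
                   (ascentParity-∷ʳ ys x) ⟩
    (∑ (map (ascends y) ys) + ascends y x) + (ascentParity ys + ∑ (map (λ z → ascends z x) ys))
      ≡⟨ interchange (∑ (map (ascends y) ys)) (ascends y x) (ascentParity ys) _ ⟩
    ascentParity (y ∷ ys) + ∑ (map (λ z → ascends z x) (y ∷ ys)) ∎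
    where open ≡-Reasoning

  -- Moving x from the front to the back reverses its order relative to every other entry.
  ascentParity-rotate : ∀ {x xs} → x ∉ xs →
    ascentParity (x ∷ xs) + ascentParity (xs ∷ʳ x) ≡ parity (length xs)
  ascentParity-rotate {x} {xs} x∉xs = begin
    (∑ (map (ascends x) xs) + ascentParity xs) + ascentParity (xs ∷ʳ x)
      ≡⟨ cong (∑ (map (ascends x) xs) + ascentParity xs +_) (ascentParity-∷ʳ xs x) ⟩
    (∑ (map (ascends x) xs) + ascentParity xs) + (ascentParity xs + ∑ (map (λ y → ascends y x) xs))
      ≡⟨ [p+q]+[q+r]≡p+r (∑ (map (ascends x) xs)) (ascentParity xs) _ ⟩
    ∑ (map (ascends x) xs) + ∑ (map (λ y → ascends y x) xs)
      ≡⟨ sym (∑-map-+ (ascends x) (λ y → ascends y x) xs) ⟩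
    ∑ (map (λ y → ascends x y + ascends y x) xs)
      ≡⟨ ∑-map-1ℙ (All.map opposite (¬Any⇒All¬ xs x∉xs)) ⟩
    parity (length xs) ∎
    where
      open ≡-Reasoning
      opposite : ∀ {y} → x ≢ y → ascends x y + ascends y x ≡ 1ℙ
      opposite {y} x≢y = ≡.trans (cong (ascends x y +_) (ascends-flip x≢y)) (p+p⁻¹≡1ℙ (ascends x y))

  disorder : (A → A) → A → A → Parity
  disorder f x y = ascends x y + ascends (f x) (f y)

  disorders : (A → A) → A → List A → Parity
  disorders f x ys = ∑ (map (disorder f x) ys)

  disorder-sym : ∀ {f} → Injective _≡_ _≡_ f → ∀ x y → disorder f x y ≡ disorder f y x
  disorder-sym {f} f-inj x y with x ≟ y
  ... | yes refl = refl
  ... | no x≢y   = begin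
    ascends x y + ascends (f x) (f y)
      ≡⟨ sym (p⁻¹+q⁻¹≡p+q (ascends x y) (ascends (f x) (f y))) ⟩
    ascends x y ⁻¹ + ascends (f x) (f y) ⁻¹
      ≡⟨ sym (cong₂ _+_ (ascends-flip x≢y) (ascends-flip (x≢y ∘ f-inj))) ⟩
    ascends y x + ascends (f y) (f x) ∎
    where open ≡-Reasoning

  disorders-↭ : ∀ f x {ys zs} → ys ↭ zs → disorders f x ys ≡ disorders f x zs
  disorders-↭ f x p = ∑-↭ (↭.map⁺ (disorder f x) p)

  -- The sign of f whenever xs lists, without repetition, a set that f permutes.
  sgn : (A → A) → List A → Parity
  sgn f xs = ascentParity xs + ascentParity (map f xs)

  sgn-∷ : ∀ f x xs → sgn f (x ∷ xs) ≡ disorders f x xs + sgn f xs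
  sgn-∷ f x xs = begin
    (∑ (map (ascends x) xs) + ascentParity xs)
      + (∑ (map (ascends (f x)) (map f xs)) + ascentParity (map f xs))
      ≡⟨ interchange (∑ (map (ascends x) xs)) (ascentParity xs) _ _ ⟩
    (∑ (map (ascends x) xs) + ∑ (map (ascends (f x)) (map f xs))) + sgn f xs
      ≡⟨ cong (λ ys → (∑ (map (ascends x) xs) + ∑ ys) + sgn f xs) (sym (List.map-∘ xs)) ⟩
    (∑ (map (ascends x) xs) + ∑ (map (ascends (f x) ∘ f) xs)) + sgn f xs
      ≡⟨ cong (_+ sgn f xs) (sym (∑-map-+ (ascends x) (ascends (f x) ∘ f) xs)) ⟩
    disorders f x xs + sgn f xs ∎
    where open ≡-Reasoning

  sgn-↭ : ∀ {f} → Injective _≡_ _≡_ f → ∀ {xs ys} → xs ↭ ys → sgn f xs ≡ sgn f ys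
  sgn-↭ f-inj refl = refl
  sgn-↭ {f} f-inj (prep {xs} {ys} x p) = begin
    sgn f (x ∷ xs)                ≡⟨ sgn-∷ f x xs ⟩
    disorders f x xs + sgn f xs   ≡⟨ cong₂ _+_ (disorders-↭ f x p) (sgn-↭ f-inj p) ⟩
    disorders f x ys + sgn f ys   ≡⟨ sym (sgn-∷ f x ys) ⟩
    sgn f (x ∷ ys)                ∎
    where open ≡-Reasoning
  sgn-↭ {f} f-inj (swap {xs} {ys} x y p) = begin
    sgn f (x ∷ y ∷ xs)
      ≡⟨ expand x y xs ⟩
    (disorder f x y + disorders f x xs) + (disorders f y xs + sgn f xs)
      ≡⟨ cong₂ _+_ (cong₂ _+_ (disorder-sym f-inj x y) (disorders-↭ f x p))
                   (cong₂ _+_ (disorders-↭ f y p) (sgn-↭ f-inj p)) ⟩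
    (disorder f y x + disorders f x ys) + (disorders f y ys + sgn f ys)
      ≡⟨ interchange (disorder f y x) (disorders f x ys) (disorders f y ys) (sgn f ys) ⟩
    (disorder f y x + disorders f y ys) + (disorders f x ys + sgn f ys)
      ≡⟨ sym (expand y x ys) ⟩
    sgn f (y ∷ x ∷ ys) ∎
    where
      open ≡-Reasoning
      expand : ∀ u v ws → sgn f (u ∷ v ∷ ws) ≡
                          (disorder f u v + disorders f u ws) + (disorders f v ws + sgn f ws)
      expand u v ws = ≡.trans (sgn-∷ f u (v ∷ ws)) (cong (disorders f u (v ∷ ws) +_) (sgn-∷ f v ws))
  sgn-↭ f-inj (trans p q) = ≡.trans (sgn-↭ f-inj p) (sgn-↭ f-inj q)

  sgn-∘ : ∀ f g xs → sgn (g ∘ f) xs ≡ sgn f xs + sgn g (map f xs)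
  sgn-∘ f g xs = begin
    ascentParity xs + ascentParity (map (g ∘ f) xs)
      ≡⟨ cong (λ ys → ascentParity xs + ascentParity ys) (List.map-∘ xs) ⟩
    ascentParity xs + ascentParity (map g (map f xs))
      ≡⟨ sym ([p+q]+[q+r]≡p+r (ascentParity xs) (ascentParity (map f xs)) _) ⟩
    sgn f xs + sgn g (map f xs) ∎
    where open ≡-Reasoning

  sgn-rotate : ∀ {f x xs} → x ∉ xs → map f (x ∷ xs) ≡ xs ∷ʳ x →
               sgn f (x ∷ xs) ≡ parity (length xs)
  sgn-rotate {f} {x} {xs} x∉xs f-rotates =
    ≡.trans (cong (λ ys → ascentParity (x ∷ xs) + ascentParity ys) f-rotates) (ascentParity-rotate x∉xs)

  sgn-rotate⁻¹ : ∀ {f x xs} → x ∉ xs → map f (xs ∷ʳ x) ≡ x ∷ xs →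
                 sgn f (xs ∷ʳ x) ≡ parity (length xs)
  sgn-rotate⁻¹ {f} {x} {xs} x∉xs f-rotates = begin
    ascentParity (xs ∷ʳ x) + ascentParity (map f (xs ∷ʳ x))
      ≡⟨ cong (λ ys → ascentParity (xs ∷ʳ x) + ascentParity ys) f-rotates ⟩
    ascentParity (xs ∷ʳ x) + ascentParity (x ∷ xs)
      ≡⟨ +-comm (ascentParity (xs ∷ʳ x)) _ ⟩
    ascentParity (x ∷ xs) + ascentParity (xs ∷ʳ x)
      ≡⟨ ascentParity-rotate x∉xs ⟩
    parity (length xs) ∎
    where open ≡-Reasoning

lookup-injective : ∀ {a} {A : Set a} {xs : List A} → Unique xs → Injective _≡_ _≡_ (lookup xs)
lookup-injective (_    ∷ _)   {zero}  {zero}  _  = refl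
lookup-injective (x∉xs ∷ _)   {zero}  {suc j} eq = contradiction eq (All.lookup x∉xs (∈-lookup j))
lookup-injective (x∉xs ∷ _)   {suc i} {zero}  eq = contradiction (sym eq) (All.lookup x∉xs (∈-lookup i))
lookup-injective (_    ∷ xs!) {suc i} {suc j} eq = cong suc (lookup-injective xs! eq)

unique-map⇒injective : ∀ {a b} {A : Set a} {B : Set b} {f : A → B} {xs} →
                       Unique (map f xs) → (∀ x → x ∈ xs) → Injective _≡_ _≡_ f
unique-map⇒injective {f = f} fxs! complete = injectiveOn fxs! (complete _) (complete _)
  where
    injectiveOn : ∀ {xs x y} → Unique (map f xs) → x ∈ xs → y ∈ xs → f x ≡ f y → x ≡ y
    injectiveOn _          (here refl) (here refl) _  = refl
    injectiveOn (fx∉ ∷ _)  (here refl) (there y∈)  eq = contradiction eq (All.lookup fx∉ (∈-map⁺ f y∈))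
    injectiveOn (fy∉ ∷ _)  (there x∈)  (here refl) eq = contradiction (sym eq) (All.lookup fy∉ (∈-map⁺ f x∈))
    injectiveOn (_ ∷ fxs!) (there x∈)  (there y∈)  eq = injectiveOn fxs! x∈ y∈ eq

unique-rotate : ∀ {a} {A : Set a} {x : A} {xs} → Unique (x ∷ xs) → Unique (xs ∷ʳ x)
unique-rotate {x = x} {xs} = ↭ₛ.Unique-resp-↭ (≡.setoid _) (↭⇒↭ₛ (↭.∷↭∷ʳ x xs))

module _ {a} {A : Set a} {f : A → A} where

  path-unique : Injective _≡_ _≡_ f → ∀ {y xs z} → map f (y ∷ xs) ≡ xs ∷ʳ z → y ∉ xs →
                Unique (y ∷ xs)
  path-unique f-inj {y} {[]}     _    _    = [] ∷ []
  path-unique f-inj {y} {w ∷ ws} path y∉xs with List.∷-injective path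
  ... | fy≡w , path′ = ¬Any⇒All¬ (w ∷ ws) y∉xs ∷ path-unique f-inj path′ w∉ws
    where
      w∉ws : w ∉ ws
      w∉ws w∈ws with ∈-map⁻ f (subst (w ∈_) (sym path′) (∈-++⁺ˡ w∈ws))
      ... | v , v∈ , w≡fv = y∉xs (subst (_∈ w ∷ ws) (f-inj (≡.trans (sym w≡fv) (sym fy≡w))) v∈)

  path-fixedPoint≡end : ∀ {x xs z y} → Unique (x ∷ xs) → map f (x ∷ xs) ≡ xs ∷ʳ z →
                        y ∈ x ∷ xs → f y ≡ y → y ≡ z
  path-fixedPoint≡end {xs = []} _ path (here refl) fx≡x =
    ≡.trans (sym fx≡x) (List.∷-injectiveˡ path)
  path-fixedPoint≡end {xs = w ∷ ws} (x∉xs ∷ xs!) path y∈ fy≡y with List.∷-injective path | y∈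
  ... | fx≡w , _     | here refl = contradiction (≡.trans (sym fy≡y) fx≡w) (All.head x∉xs)
  ... | _    , path′ | there y∈xs = path-fixedPoint≡end xs! path′ y∈xs fy≡y

  cycle-noFixedPoint : ∀ {x xs y} → Unique (x ∷ xs) → map f (x ∷ xs) ≡ xs ∷ʳ x → xs ≢ [] →
                       y ∈ x ∷ xs → f y ≢ y
  cycle-noFixedPoint {xs = []}     _                 _     nonempty _  _    = nonempty refl
  cycle-noFixedPoint {xs = w ∷ ws} cycle!@(x∉xs ∷ _) cycle _ y∈ fy≡y
    with refl ← path-fixedPoint≡end cycle! cycle y∈ fy≡y
    = All.head x∉xs (≡.trans (sym fy≡y) (List.∷-injectiveˡ cycle))

module FinInversionParity {k : ℕ} = InversionParity (Fin.<-isStrictTotalOrder {k})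
open FinInversionParity

sign : ∀ {k} → (Fin k → Fin k) → Parity
sign {k} f = sgn f (allFin k)

unique⇒length≤ : ∀ {k} {xs : List (Fin k)} → Unique xs → length xs ≤ k
unique⇒length≤ xs! = Fin.injective⇒≤ (lookup-injective xs!)

_∈?_ : ∀ {k} (z : Fin k) xs → Dec (z ∈ xs)
_∈?_ = DecMembership._∈?_ Fin._≟_

length-allFin : ∀ k → length (allFin k) ≡ k
length-allFin k = List.length-tabulate {n = k} (λ i → i)

unique-full⇒complete : ∀ {k} {xs : List (Fin k)} → Unique xs → length xs ≡ k → ∀ z → z ∈ xs
unique-full⇒complete {xs = xs} xs! full z with z ∈? xs
... | yes z∈xs = z∈xs
... | no  z∉xs = contradiction (unique⇒length≤ (¬Any⇒All¬ xs z∉xs ∷ xs!)) (ℕ.<-irrefl full)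

unique∧complete⇒↭allFin : ∀ {k} {xs : List (Fin k)} → Unique xs → (∀ z → z ∈ xs) → xs ↭ allFin k
unique∧complete⇒↭allFin {k} xs! complete =
  ∼bag⇒↭ (unique∧set⇒bag xs! (Unique.allFin⁺ k) (mk⇔ (λ _ → ∈-allFin _) (λ _ → complete _)))

unique-short⇒missing : ∀ {k} {xs : List (Fin k)} → Unique xs → length xs < k → ∃ λ z → z ∉ xs
unique-short⇒missing {k} {xs} xs! short = Fin.¬∀⟶∃¬ k (_∈ xs) (_∈? xs) λ complete →
  ℕ.<-irrefl (≡.trans (↭.↭-length (unique∧complete⇒↭allFin xs! complete)) (length-allFin k)) short

missing-unique : ∀ {k} {xs : List (Fin k)} → Unique xs → suc (length xs) ≡ k →
                 ∀ {y z} → y ∉ xs → z ∉ xs → y ≡ z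
missing-unique {xs = xs} xs! almostFull {y} {z} y∉xs z∉xs with y Fin.≟ z
... | yes y≡z = y≡z
... | no  y≢z = contradiction (unique⇒length≤ y∷z∷xs!) (ℕ.<-irrefl almostFull)
  where
    y∷z∷xs! : Unique (y ∷ z ∷ xs)
    y∷z∷xs! = (y≢z ∷ ¬Any⇒All¬ xs y∉xs) ∷ ¬Any⇒All¬ xs z∉xs ∷ xs!

sign-∘ : ∀ {k} {f g : Fin k → Fin k} → Injective _≡_ _≡_ f → Injective _≡_ _≡_ g →
         sign (g ∘ f) ≡ sign f + sign g
sign-∘ {k} {f} {g} f-inj g-inj =
  ≡.trans (sgn-∘ f g (allFin k))
          (cong (sign f +_) (sgn-↭ g-inj (unique∧complete⇒↭allFin f[allFin]! complete)))
  where
    f[allFin]! : Unique (map f (allFin k))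
    f[allFin]! = Unique.map⁺ f-inj (Unique.allFin⁺ k)
    complete : ∀ z → z ∈ map f (allFin k)
    complete = unique-full⇒complete f[allFin]!
                 (≡.trans (List.length-map f (allFin k)) (length-allFin k))

sign-cycle : ∀ {k} {f : Fin k → Fin k} {x xs} → Injective _≡_ _≡_ f →
             Unique (x ∷ xs) → (∀ z → z ∈ x ∷ xs) → map f (x ∷ xs) ≡ xs ∷ʳ x →
             sign f ≡ parity (length xs)
sign-cycle {xs = xs} f-inj cycle!@(x∉xs ∷ _) complete rotates =
  ≡.trans (sym (sgn-↭ f-inj (unique∧complete⇒↭allFin cycle! complete)))
          (sgn-rotate (All¬⇒¬Any x∉xs) rotates)

sign-cycle⁻¹ : ∀ {k} {f : Fin k → Fin k} {x xs} → Injective _≡_ _≡_ f →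
               Unique (x ∷ xs) → (∀ z → z ∈ x ∷ xs) → map f (xs ∷ʳ x) ≡ x ∷ xs →
               sign f ≡ parity (length xs)
sign-cycle⁻¹ {x = x} {xs} f-inj cycle!@(x∉xs ∷ _) complete rotates =
  ≡.trans (sym (sgn-↭ f-inj (↭-trans (↭-sym (↭.∷↭∷ʳ x xs))
                                     (unique∧complete⇒↭allFin cycle! complete))))
          (sgn-rotate⁻¹ (All¬⇒¬Any x∉xs) rotates)

almostFullCycle⇒uniqueFixedPoint :
  ∀ {k} {f : Fin k → Fin k} {x xs} → Injective _≡_ _≡_ f →
  Unique (x ∷ xs) → map f (x ∷ xs) ≡ xs ∷ʳ x → xs ≢ [] → suc (length (x ∷ xs)) ≡ k →
  ∃ λ z → z ∉ x ∷ xs × f z ≡ z × (∀ y → f y ≡ y → y ≡ z)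
almostFullCycle⇒uniqueFixedPoint {f = f} {x} {xs} f-inj cycle! cycle nonempty almostFull
  with z , z∉ ← unique-short⇒missing cycle! (ℕ.≤-reflexive almostFull)
  = z , z∉ , missing-unique cycle! almostFull fz∉ z∉ , fixed≡z
  where
    fz∉ : f z ∉ x ∷ xs
    fz∉ fz∈ with ∈-map⁻ f (subst (f z ∈_) (sym cycle) (↭.∈-resp-↭ (↭.∷↭∷ʳ x xs) fz∈))
    ... | w , w∈ , fz≡fw = z∉ (subst (_∈ x ∷ xs) (sym (f-inj fz≡fw)) w∈)
    fixed≡z : ∀ y → f y ≡ y → y ≡ z
    fixed≡z y fy≡y =
      missing-unique cycle! almostFull (λ y∈ → cycle-noFixedPoint cycle! cycle nonempty y∈ fy≡y) z∉

module _ {k} (f : Fin (suc k) → Fin (suc k)) where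

  cycleFrom-path : ∀ g {y x} → f y ≡ x →
    ∃ λ z → map f (y ∷ cycleFrom f g x) ≡ cycleFrom f g x ∷ʳ z ×
            (z ≡ zero ⊎ length (cycleFrom f g x) ≡ g)
  cycleFrom-path zero    {x = x}     fy≡x = x , cong (_∷ []) fy≡x , inj₂ refl
  cycleFrom-path (suc g) {x = zero}  fy≡0 = zero , cong (_∷ []) fy≡0 , inj₁ refl
  cycleFrom-path (suc g) {x = suc x} fy≡x with cycleFrom-path g {suc x} refl
  ... | z , path , closes = z , cong₂ _∷_ fy≡x path , Sum.map₂ (cong suc) closes

  cycleFrom-nonzero : ∀ g x → zero ∉ cycleFrom f g x
  cycleFrom-nonzero zero    _       ()
  cycleFrom-nonzero (suc g) zero    ()
  cycleFrom-nonzero (suc g) (suc x) (there 0∈) = cycleFrom-nonzero g (f (suc x)) 0∈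

  -- The fuel suc k suffices: the orbit has no repetitions, so it closes before the fuel runs out.
  cycleFrom-cycle : Injective _≡_ _≡_ f →
    let orbit = cycleFrom f (suc k) (f zero) in
    Unique (zero ∷ orbit) × map f (zero ∷ orbit) ≡ orbit ∷ʳ zero
  cycleFrom-cycle f-inj with cycleFrom-path (suc k) {zero} refl
  ... | z , path , closes = orbit! , subst (λ z → map f (zero ∷ orbit) ≡ orbit ∷ʳ z) z≡0 path
    where
      orbit = cycleFrom f (suc k) (f zero)
      orbit! : Unique (zero ∷ orbit)
      orbit! = path-unique f-inj path (cycleFrom-nonzero (suc k) (f zero))
      z≡0 : z ≡ zero
      z≡0 = Sum.fromInj₁ (λ full → contradiction (unique⇒length≤ orbit!) (ℕ.<-irrefl full)) closes

after-length : ∀ {k} (t : Fin k) xs → 0 < length (after t xs) →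
               t ∈ xs × length (after t xs) < length xs
after-length t []       ()
after-length t (x ∷ xs) nonempty with x Fin.≟ t
... | yes refl = here refl , ℕ.n<1+n (length xs)
... | no  _    with t∈ , shorter ← after-length t xs nonempty = there t∈ , ℕ.m<n⇒m<1+n shorter

tabulate-∷ʳ : ∀ {a} {A : Set a} n (f : Fin (suc n) → A) →
              tabulate f ≡ tabulate (f ∘ inject₁) ∷ʳ f (fromℕ n)
tabulate-∷ʳ zero    f = refl
tabulate-∷ʳ (suc n) f = cong (f zero ∷_) (tabulate-∷ʳ n (f ∘ suc))

module _ {n : ℕ} where

  X-successor : ∀ {x y : Fin (suc n)} → toℕ y ≡ suc (toℕ x) → Xcyc n x ≡ y
  X-successor {x} {y} y≡1+x with toℕ x ℕ.<? n
  ... | yes x<n = Fin.toℕ-injective (≡.trans (cong suc (Fin.toℕ-fromℕ< x<n)) (sym y≡1+x))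
  ... | no  x≮n = contradiction (ℕ.s<s⁻¹ (subst (_< suc n) y≡1+x (Fin.toℕ<n y))) x≮n

  X-toℕ : ∀ {x : Fin (suc n)} → x ≢ fromℕ n → toℕ (Xcyc n x) ≡ suc (toℕ x)
  X-toℕ {x} x≢top with toℕ x ℕ.<? n
  ... | yes x<n = cong suc (Fin.toℕ-fromℕ< x<n)
  ... | no  x≮n = contradiction (Fin.toℕ-injective (≡.trans x≡n (sym (Fin.toℕ-fromℕ n)))) x≢top
    where x≡n = ℕ.≤-antisym (Fin.toℕ≤pred[n] x) (ℕ.≮⇒≥ x≮n)

  X-top : Xcyc n (fromℕ n) ≡ zero
  X-top with toℕ (fromℕ n) ℕ.<? n
  ... | yes top<n = contradiction top<n (ℕ.<-irrefl (Fin.toℕ-fromℕ n))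
  ... | no  _     = refl

  X-rotates : map (Xcyc n) (allFin (suc n)) ≡ tabulate suc ∷ʳ zero
  X-rotates = begin
    map (Xcyc n) (allFin (suc n))
      ≡⟨ List.map-tabulate (λ i → i) (Xcyc n) ⟩
    tabulate (Xcyc n)
      ≡⟨ tabulate-∷ʳ n (Xcyc n) ⟩
    tabulate (Xcyc n ∘ inject₁) ∷ʳ Xcyc n (fromℕ n)
      ≡⟨ cong₂ _∷ʳ_ (List.tabulate-cong X-inject₁) X-top ⟩
    tabulate suc ∷ʳ zero ∎
    where
      open ≡-Reasoning
      X-inject₁ : ∀ i → Xcyc n (inject₁ i) ≡ suc i
      X-inject₁ i = X-successor (cong suc (sym (Fin.toℕ-inject₁ i)))

  X-injective : Injective _≡_ _≡_ (Xcyc n)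
  X-injective = unique-map⇒injective
    (subst Unique (sym X-rotates) (unique-rotate (Unique.allFin⁺ (suc n)))) ∈-allFin

  sign-X : sign (Xcyc n) ≡ parity n
  sign-X = ≡.trans (sign-cycle X-injective (Unique.allFin⁺ (suc n)) ∈-allFin X-rotates)
                   (cong parity (List.length-tabulate {n = n} suc))

module CycleStructure (m : ℕ) (π : Permutation′ (suc m)) where

  top : Fin (suc (suc m))
  top = fromℕ (suc m)

  π-injective : Injective _≡_ _≡_ (π ⟨$⟩ʳ_)
  π-injective eq = ≡.trans (sym (inverseˡ π)) (≡.trans (cong (π ⟨$⟩ˡ_) eq) (inverseˡ π))

  value : Fin (suc m) → Fin (suc (suc m))
  value i = suc (π ⟨$⟩ʳ i)

  values : List (Fin (suc (suc m)))
  values = tabulate value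

  Y-first : Ycyc m π (value zero) ≡ zero
  Y-first rewrite inverseˡ π {zero} = refl

  Y-next : ∀ i → Ycyc m π (value (suc i)) ≡ value (inject₁ i)
  Y-next i rewrite inverseˡ π {suc i} = refl

  Y-rotates : map (Ycyc m π) (values ∷ʳ zero) ≡ zero ∷ values
  Y-rotates = begin
    map (Ycyc m π) (values ∷ʳ zero)
      ≡⟨ List.map-++ (Ycyc m π) values (zero ∷ []) ⟩
    map (Ycyc m π) values ∷ʳ value (fromℕ m)
      ≡⟨ cong (_∷ʳ value (fromℕ m)) (List.map-tabulate value (Ycyc m π)) ⟩
    tabulate (Ycyc m π ∘ value) ∷ʳ value (fromℕ m)
      ≡⟨ cong (_∷ʳ value (fromℕ m)) (cong₂ _∷_ Y-first (List.tabulate-cong Y-next)) ⟩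
    zero ∷ tabulate (value ∘ inject₁) ∷ʳ value (fromℕ m)
      ≡⟨ cong (zero ∷_) (sym (tabulate-∷ʳ m value)) ⟩
    zero ∷ values ∎
    where open ≡-Reasoning

  zero∷values! : Unique (zero ∷ values)
  zero∷values! = Allₚ.tabulate⁺ {f = value} (λ _ ())
               ∷ Unique.tabulate⁺ {f = value} (π-injective ∘ Fin.suc-injective)

  zero∷values-complete : ∀ z → z ∈ zero ∷ values
  zero∷values-complete zero    = here refl
  zero∷values-complete (suc v) =
    there (subst (_∈ values) (cong suc (inverseʳ π)) (∈-tabulate⁺ {f = value} (π ⟨$⟩ˡ v)))

  Y-injective : Injective _≡_ _≡_ (Ycyc m π)
  Y-injective = unique-map⇒injective (subst Unique (sym Y-rotates) zero∷values!)
                  (λ z → ↭.∈-resp-↭ (↭.∷↭∷ʳ zero values) (zero∷values-complete z))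

  sign-Y : sign (Ycyc m π) ≡ parity (suc m)
  sign-Y = ≡.trans (sign-cycle⁻¹ Y-injective zero∷values! zero∷values-complete Y-rotates)
                   (cong parity (List.length-tabulate value))

  C-injective : Injective _≡_ _≡_ (Ccyc m π)
  C-injective = X-injective {suc m} ∘ Y-injective

  sign-C : sign (Ccyc m π) ≡ 0ℙ
  sign-C = ≡.trans (sign-∘ (X-injective {suc m}) Y-injective)
                   (≡.trans (cong₂ _+_ (sign-X {suc m}) sign-Y) (p+p≡0ℙ (parity (suc m))))

  orbit : List (Fin (suc (suc m)))
  orbit = cycleFrom (Ccyc m π) (suc (suc m)) (Ccyc m π zero)

  zero∷orbit! : Unique (zero ∷ orbit)
  zero∷orbit! = proj₁ (cycleFrom-cycle (Ccyc m π) C-injective)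

  C-rotates : map (Ccyc m π) (zero ∷ orbit) ≡ orbit ∷ʳ zero
  C-rotates = proj₂ (cycleFrom-cycle (Ccyc m π) C-injective)

  orbit-notFull : parity (suc m) ≡ 1ℙ → length orbit ≢ suc m
  orbit-notFull odd full = contradiction 0ℙ≡1ℙ λ ()
    where
      open ≡-Reasoning
      complete = unique-full⇒complete zero∷orbit! (cong suc full)
      0ℙ≡1ℙ : 0ℙ ≡ 1ℙ
      0ℙ≡1ℙ = begin
        0ℙ                     ≡⟨ sign-C ⟨
        sign (Ccyc m π)        ≡⟨ sign-cycle C-injective zero∷orbit! complete C-rotates ⟩
        parity (length orbit)  ≡⟨ cong parity full ⟩
        parity (suc m)         ≡⟨ odd ⟩
        1ℙ                     ∎

  adjacency⇒fixed : ∀ {i} → IsAdjacency π i → Ccyc m π (value i) ≡ value i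
  adjacency⇒fixed {i} (suc j , j≡1+i , next) = begin
    Ycyc m π (Xcyc (suc m) (value i)) ≡⟨ cong (Ycyc m π) (X-successor next) ⟩
    Ycyc m π (value (suc j))          ≡⟨ Y-next j ⟩
    value (inject₁ j)                 ≡⟨ cong value j≡i ⟩
    value i                           ∎
    where
      open ≡-Reasoning
      j≡i = Fin.toℕ-injective (≡.trans (Fin.toℕ-inject₁ j) (ℕ.suc-injective j≡1+i))

  fixed⇒adjacency : ∀ {v} → Ccyc m π (suc v) ≡ suc v → suc v ≢ top →
                    ∃ λ i → IsAdjacency π i × π ⟨$⟩ʳ i ≡ v
  fixed⇒adjacency {v} fixed v≢top = fromSuccessor (Xcyc (suc m) (suc v)) (X-toℕ v≢top) fixed
    where
      fromPosition : ∀ j → toℕ (π ⟨$⟩ʳ j) ≡ suc (toℕ v) → Ycyc m π (value j) ≡ suc v →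
                     ∃ λ i → IsAdjacency π i × π ⟨$⟩ʳ i ≡ v
      fromPosition zero    _    Y≡v = contradiction (≡.trans (sym Y-first) Y≡v) λ ()
      fromPosition (suc i) next Y≡v =
        inject₁ i , (suc i , cong suc (sym (Fin.toℕ-inject₁ i)) , cong suc next′) , πi≡v
        where
          πi≡v = Fin.suc-injective (≡.trans (sym (Y-next i)) Y≡v)
          next′ = ≡.trans next (cong (suc ∘ toℕ) (sym πi≡v))
      fromSuccessor : ∀ u → toℕ u ≡ suc (toℕ (suc v)) → Ycyc m π u ≡ suc v →
                      ∃ λ i → IsAdjacency π i × π ⟨$⟩ʳ i ≡ v
      fromSuccessor (suc w) u≡ Y≡v = fromPosition (π ⟨$⟩ˡ w)
        (≡.trans (cong toℕ (inverseʳ π)) (ℕ.suc-injective u≡))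
        (≡.trans (cong (Ycyc m π ∘ suc) (inverseʳ π)) Y≡v)

  orbit-almostFull : parity (suc m) ≡ 1ℙ → 0 < length (SP (suc m) π) →
                     suc (length (SP (suc m) π)) ≡ m → top ∈ orbit × length orbit ≡ m
  orbit-almostFull odd nonempty 1+|SP|≡m with top∈ , shorter ← after-length top orbit nonempty =
    top∈ , ℕ.≤-antisym (ℕ.s≤s⁻¹ |orbit|<1+m) (subst (_≤ length orbit) 1+|SP|≡m shorter)
    where
      |orbit|<1+m : length orbit < suc m
      |orbit|<1+m = ℕ.≤∧≢⇒< (ℕ.s≤s⁻¹ (unique⇒length≤ zero∷orbit!)) (orbit-notFull odd)

  uniqueAdjacency : parity (suc m) ≡ 1ℙ → 0 < length (SP (suc m) π) →
                    suc (length (SP (suc m) π)) ≡ m → ∃! _≡_ (IsAdjacency π)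
  uniqueAdjacency odd nonempty 1+|SP|≡m =
    fromFixedPoint (almostFullCycle⇒uniqueFixedPoint C-injective zero∷orbit! C-rotates
                      (λ orbit≡[] → ¬Any[] (subst (top ∈_) orbit≡[] top∈)) (cong (2 ℕ.+_) |orbit|≡m))
    where
      top∈ = proj₁ (orbit-almostFull odd nonempty 1+|SP|≡m)
      |orbit|≡m = proj₂ (orbit-almostFull odd nonempty 1+|SP|≡m)
      ≢top : ∀ {z} → z ∉ zero ∷ orbit → z ≢ top
      ≢top z∉ z≡top = z∉ (there (subst (_∈ orbit) (sym z≡top) top∈))
      fromFixedPoint : (∃ λ z → z ∉ zero ∷ orbit × Ccyc m π z ≡ z ×
                                (∀ y → Ccyc m π y ≡ y → y ≡ z)) →
                       ∃! _≡_ (IsAdjacency π)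
      fromFixedPoint (zero  , 0∉ , _) = contradiction (here refl) 0∉
      fromFixedPoint (suc v , v∉ , fixed , only-v)
        with i , adjacent , πi≡v ← fixed⇒adjacency fixed (≢top v∉)
        = i , adjacent , λ adjacent′ →
            π-injective (≡.trans πi≡v (Fin.suc-injective (sym (only-v _ (adjacency⇒fixed adjacent′)))))

%2≡1⇒parity≡1ℙ : ∀ n → n % 2 ≡ 1 → parity n ≡ 1ℙ
%2≡1⇒parity≡1ℙ 0             ()
%2≡1⇒parity≡1ℙ 1             _   = refl
%2≡1⇒parity≡1ℙ (suc (suc n)) odd = %2≡1⇒parity≡1ℙ n odd

lemma3p11 : (n : ℕ) → 1 < n → n % 2 ≡ 1 → (π : Permutation′ n) →
    length (SP n π) ≡ n ∸ 2 → ∃! _≡_ (IsAdjacency π)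
lemma3p11 0 () _ _ _
lemma3p11 1 (s≤s ()) _ _ _
lemma3p11 2 _ () _ _
lemma3p11 (suc (suc (suc k))) _ odd π |SP|≡n∸2 =
  CycleStructure.uniqueAdjacency (suc (suc k)) π (%2≡1⇒parity≡1ℙ (suc (suc (suc k))) odd)
    (subst (0 <_) (sym |SP|≡n∸2) (s≤s z≤n)) (cong suc |SP|≡n∸2)
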